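{- Let $i=i_0i_1i_2\cdots$ be an interaction sequence and let $I$ be a union of isolated intervals of $i$. Then $I$ is isolated and $i-I$ is either empty or an interaction sequence.
   Context: A pointer sequence is a finite or infinite sequence $i_0i_1i_2\cdots$ of natural numbers with $i_0=0$ and $i_{n+1}<n+1$; its domain is $\mathrm{dom}(i)=\{0,1,\dots\}$ (the set of indices). It is an interaction sequence if $i_{n+1}\in V(n+1)$ for all $n$, where $V(0)=\emptyset$ and $V(n+1)=\{n\}\cup V(i_n)$. A set $I\subseteq\mathrm{dom}(i)$ is isolated if for all $n$, $i_n\in I$ implies $n\in I$. An interval of $i$ is a set $[i_m,m]=\{k\mid i_m\le k\le m\}$. For isolated $I$, $i-I$ is the empty sequence if $I=\mathrm{dom}(i)$, and otherwise the unique pointer sequence $j$ such that $i_{e(n)}=e(j_n)$ for all $n$, where $e(0)<e(1)<\cdots$ enumerates $\mathrm{dom}(i)\setminus I$. -}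

module Defs where

open import Data.Nat using (ℕ; zero; suc; _≤_; _<_)
open import Data.Unit using (⊤)
open import Data.Product using (Σ; ∃; ∃-syntax; _×_)
open import Data.Sum using (_⊎_)
open import Relation.Nullary using (¬_)
open import Relation.Binary.PropositionalEquality using (_≡_)

data Len : Set where
  fin : ℕ → Len
  inf : Len

_∈dom_ : ℕ → Len → Set
k ∈dom fin n = k < n
k ∈dom inf = ⊤

-- A (finite or infinite) sequence of naturals: its length and its entries
-- (entries outside the domain are irrelevant junk).
record Seq : Set where
  constructor mkSeq
  field
    len : Len
    at  : ℕ → ℕ
open Seq public

Dom : Seq → ℕ → Set
Dom i k = k ∈dom len i

IsPointer : Seq → Set
IsPointer i = Dom i 0 × at i 0 ≡ 0
            × (∀ n → Dom i (suc n) → at i (suc n) < suc n)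

-- V i m k  means  k ∈ V(m), where V(0) = ∅, V(n+1) = {n} ∪ V(i_n).
data V (i : ℕ → ℕ) : ℕ → ℕ → Set where
  here  : ∀ n → V i (suc n) n
  there : ∀ n k → V i (i n) k → V i (suc n) k

IsInteraction : Seq → Set
IsInteraction i = IsPointer i × (∀ n → Dom i (suc n) → V (at i) (suc n) (at i (suc n)))

Isolated : Seq → (ℕ → Set) → Set
Isolated i I = (∀ k → I k → Dom i k) × (∀ n → Dom i n → I (at i n) → I n)

Interval : Seq → ℕ → ℕ → Set
Interval i m k = at i m ≤ k × k ≤ m

UnionOfIntervals : Seq → (ℕ → Set) → ℕ → Set
UnionOfIntervals i M k = ∃[ m ] (M m × Interval i m k)

-- j = i - I (I ≠ dom(i)): j is a pointer sequence and, with e the increasing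
-- enumeration of dom(i) \ I (e : dom(j) → dom(i) \ I strictly increasing and
-- onto), i_{e(n)} = e(j_n) for all n ∈ dom(j).
IsMinus : Seq → (ℕ → Set) → Seq → Set
IsMinus i I j = IsPointer j × Σ (ℕ → ℕ) λ e →
    (∀ m n → Dom j n → m < n → e m < e n)
  × (∀ n → Dom j n → Dom i (e n) × ¬ I (e n))
  × (∀ k → Dom i k → ¬ I k → ∃[ n ] (Dom j n × e n ≡ k))
  × (∀ n → Dom j n → at i (e n) ≡ e (at j n))

-- Let U be the union of the intervals and call the positions of dom(i) outside U kept.
-- Isolation of U is immediate, and since U is isolated, a kept position points to a
-- kept position.  Numbering the kept positions increasingly gives i - U: with
-- count k the number of kept positions below k, the removed sequence is
-- j_{count k} = count (i_k) for kept k.  Call q a cut if no interval [i_m, m] with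
-- m ∈ M crosses the boundary between q - 1 and q; every kept position is a cut,
-- and i_p is a cut whenever p + 1 is.  For a cut p + 1, the visible set V_j of
-- count (i_p) is contained in that of count (p + 1): either p is kept, and then
-- count (p + 1) = count p + 1 with j_{count p} = count (i_p), or p is the right end
-- of a removed interval [i_p, p], and then count (p + 1) = count (i_p).  By
-- induction on V_i this maps kept members of V_i(q) into V_j(count q) for cuts q,
-- which for q kept is the interaction property of j.
module Submission where

open import Defs
open import Data.Nat using (ℕ; zero; suc; _≤_; _<_; z≤n; s≤s; _≤′_; ≤′-refl; ≤′-step; _≤?_; _<?_)
open import Data.Nat.Properties
open import Data.Product using (Σ; ∃; ∃-syntax; _×_; _,_; proj₁; proj₂)
open import Data.Sum using (_⊎_; inj₁; inj₂)
open import Data.Unit using (tt)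
open import Data.Empty using (⊥-elim)
open import Relation.Nullary using (¬_; yes; no)
open import Relation.Binary.PropositionalEquality using (_≡_; refl; sym; trans; cong; subst; subst₂)
open import Relation.Binary.Definitions using (tri<; tri≈; tri>)
open import Axiom.ExcludedMiddle using (ExcludedMiddle)
import Level

∈dom-downward : ∀ (l : Len) {a b} → b ∈dom l → a ≤ b → a ∈dom l
∈dom-downward (fin n) b<n a≤b = ≤-<-trans a≤b b<n
∈dom-downward inf _ _ = tt

module Enumeration (em : ExcludedMiddle Level.zero) (P : ℕ → Set) where

  count : ℕ → ℕ
  count zero = zero
  count (suc k) with em {P k}
  ... | yes _ = suc (count k)
  ... | no _ = count k

  count-suc-yes : ∀ {k} → P k → count (suc k) ≡ suc (count k)
  count-suc-yes {k} Pk with em {P k}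
  ... | yes _ = refl
  ... | no ¬Pk = ⊥-elim (¬Pk Pk)

  count-suc-no : ∀ {k} → ¬ P k → count (suc k) ≡ count k
  count-suc-no {k} ¬Pk with em {P k}
  ... | yes Pk = ⊥-elim (¬Pk Pk)
  ... | no _ = refl

  count-mono : ∀ {a b} → a ≤ b → count a ≤ count b
  count-mono a≤b = go (≤⇒≤′ a≤b)
    where
    count-suc-≥ : ∀ k → count k ≤ count (suc k)
    count-suc-≥ k with em {P k}
    ... | yes _ = n≤1+n (count k)
    ... | no _ = ≤-refl

    go : ∀ {a b} → a ≤′ b → count a ≤ count b
    go ≤′-refl = ≤-refl
    go {b = suc b} (≤′-step a≤′b) = ≤-trans (go a≤′b) (count-suc-≥ b)

  count-< : ∀ {k k′} → P k → k < k′ → count k < count k′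
  count-< Pk k<k′ = subst (_≤ _) (count-suc-yes Pk) (count-mono k<k′)

  count-injective : ∀ {k k′} → P k → P k′ → count k ≡ count k′ → k ≡ k′
  count-injective {k} {k′} Pk Pk′ eq with <-cmp k k′
  ... | tri< k<k′ _ _ = ⊥-elim (<-irrefl eq (count-< Pk k<k′))
  ... | tri≈ _ k≡k′ _ = k≡k′
  ... | tri> _ _ k′<k = ⊥-elim (<-irrefl (sym eq) (count-< Pk′ k′<k))

  count-const : ∀ {a q} → a ≤ q → (∀ k → a ≤ k → k < q → ¬ P k) → count q ≡ count a
  count-const {q = zero} z≤n _ = refl
  count-const {a} {suc q} a≤q none with m≤n⇒m<n∨m≡n a≤q
  ... | inj₂ a≡q = cong count (sym a≡q)
  ... | inj₁ a<q = trans (count-suc-no (none q (≤-pred a<q) ≤-refl))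
                         (count-const (≤-pred a<q) (λ k a≤k k<q → none k a≤k (m<n⇒m<1+n k<q)))

  IsRank : ℕ → Set
  IsRank n = ∃[ k ] (P k × count k ≡ n)

  <count⇒IsRank : ∀ {n} q → n < count q → IsRank n
  <count⇒IsRank zero ()
  <count⇒IsRank {n} (suc q) n<count with em {P q}
  ... | no _ = <count⇒IsRank q n<count
  ... | yes Pq with m≤n⇒m<n∨m≡n (≤-pred n<count)
  ...   | inj₁ n<count′ = <count⇒IsRank q n<count′
  ...   | inj₂ n≡count = q , Pq , sym n≡count

  Bounded : Set
  Bounded = ∃[ B ] (∀ k → P k → k < B)

  ¬Bounded⇒count-unbounded : ¬ Bounded → ∀ n → ∃[ q ] (n < count q)
  ¬Bounded⇒count-unbounded unbounded = grow
    where
    beyond : ∀ N → ∃[ k ] (P k × N ≤ k)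
    beyond N with em {∃[ k ] (P k × N ≤ k)}
    ... | yes found = found
    ... | no none = ⊥-elim (unbounded (N , below))
      where
      below : ∀ k → P k → k < N
      below k Pk with k <? N
      ... | yes k<N = k<N
      ... | no k≮N = ⊥-elim (none (k , Pk , ≮⇒≥ k≮N))

    grow : ∀ n → ∃[ q ] (n < count q)
    grow zero with beyond 0
    ... | k , Pk , _ = suc k , subst (0 <_) (sym (count-suc-yes Pk)) (s≤s z≤n)
    grow (suc n) with grow n
    ... | q , n<count with beyond q
    ...   | k , Pk , q≤k =
      suc k , subst (suc n <_) (sym (count-suc-yes Pk)) (s≤s (<-≤-trans n<count (count-mono q≤k)))

  ranks : Σ Len λ l → (∀ n → n ∈dom l → IsRank n) × (∀ k → P k → count k ∈dom l)
  ranks with em {Bounded}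
  ... | yes (B , bound) =
    fin (count B) , (λ n → <count⇒IsRank B)
                  , (λ k Pk → <-≤-trans (count-< Pk (n<1+n k)) (count-mono (bound k Pk)))
  ... | no unbounded =
    inf , (λ n _ → let (q , n<count) = ¬Bounded⇒count-unbounded unbounded n
                   in <count⇒IsRank q n<count)
        , (λ _ _ → tt)

  rankLen : Len
  rankLen = proj₁ ranks

  ∈rankLen⇒IsRank : ∀ n → n ∈dom rankLen → IsRank n
  ∈rankLen⇒IsRank = proj₁ (proj₂ ranks)

  count∈rankLen : ∀ k → P k → count k ∈dom rankLen
  count∈rankLen = proj₂ (proj₂ ranks)

  -- The n-th element of P, with junk value 0 when there is none.
  enum : ℕ → ℕ
  enum n with em {IsRank n}
  ... | yes (k , _) = k
  ... | no _ = 0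

  enum-spec : ∀ {n} → IsRank n → P (enum n) × count (enum n) ≡ n
  enum-spec {n} rank with em {IsRank n}
  ... | yes (_ , Pk , count≡n) = Pk , count≡n
  ... | no ¬rank = ⊥-elim (¬rank rank)

  enum-count : ∀ {k} → P k → enum (count k) ≡ k
  enum-count {k} Pk =
    let (Penum , count≡) = enum-spec (k , Pk , refl)
    in count-injective Penum Pk count≡

  enum-< : ∀ {m n} → IsRank n → m < n → enum m < enum n
  enum-< {m} {n} rank m<n with enum n ≤? enum m
  ... | no enum-n≰enum-m = ≰⇒> enum-n≰enum-m
  ... | yes enum-n≤enum-m =
    ⊥-elim (<⇒≱ m<n (subst₂ _≤_ (proj₂ (enum-spec rank)) (proj₂ (enum-spec rank-m))
                                 (count-mono enum-n≤enum-m)))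
    where
    rank-m : IsRank m
    rank-m = <count⇒IsRank (enum n) (subst (m <_) (sym (proj₂ (enum-spec rank))) m<n)

at-≤ : ∀ i {k} → IsPointer i → Dom i k → at i k ≤ k
at-≤ _ {k = zero} (_ , at0≡0 , _) _ = subst (_≤ 0) (sym at0≡0) ≤-refl
at-≤ _ {k = suc p} (_ , _ , at<) dom = <⇒≤ (at< p dom)

at-< : ∀ i {k} → IsPointer i → Dom i k → 0 < k → at i k < k
at-< _ {k = suc p} (_ , _ , at<) dom _ = at< p dom

at∈V : ∀ i {k} → IsInteraction i → Dom i k → 0 < k → V (at i) k (at i k)
at∈V _ {k = suc p} (_ , at∈) dom _ = at∈ p dom

union-isolated : ∀ i M → (∀ m → M m → Dom i m × Isolated i (Interval i m))
               → Isolated i (UnionOfIntervals i M)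
union-isolated i M isolated =
    (λ k (m , Mm , _ , k≤m) → ∈dom-downward (len i) (proj₁ (isolated m Mm)) k≤m)
  , (λ n dom (m , Mm , atn∈) → m , Mm , proj₂ (proj₂ (isolated m Mm)) n dom atn∈)

module Removal (em : ExcludedMiddle Level.zero) (i : Seq) (interaction : IsInteraction i)
  (M : ℕ → Set) (isolated : ∀ m → M m → Dom i m × Isolated i (Interval i m)) where

  pointer : IsPointer i
  pointer = proj₁ interaction

  U : ℕ → Set
  U = UnionOfIntervals i M

  U-isolated : Isolated i U
  U-isolated = union-isolated i M isolated

  Kept : ℕ → Set
  Kept k = Dom i k × ¬ U k

  Kept-at : ∀ {k} → Kept k → Kept (at i k)
  Kept-at (dom , ¬Uk) = ∈dom-downward (len i) dom (at-≤ i pointer dom)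
                      , (λ Uat → ¬Uk (proj₂ U-isolated _ dom Uat))

  open Enumeration em Kept

  j : Seq
  j = mkSeq rankLen (λ n → count (at i (enum n)))

  at-j-count : ∀ {k} → Kept k → at j (count k) ≡ count (at i k)
  at-j-count kept = cong (λ k → count (at i k)) (enum-count kept)

  Cut : ℕ → Set
  Cut q = ∀ m → M m → at i m < q → m < q

  Kept⇒Cut : ∀ {q} → Kept q → Cut q
  Kept⇒Cut {q} (_ , ¬Uq) m Mm atm<q with q ≤? m
  ... | yes q≤m = ⊥-elim (¬Uq (m , Mm , <⇒≤ atm<q , q≤m))
  ... | no q≰m = ≰⇒> q≰m

  Cut-at : ∀ {p} → Dom i p → Cut (suc p) → Cut (at i p)
  Cut-at {p} dom cut m Mm atm<atp with at i p ≤? m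
  ... | no atp≰m = ≰⇒> atp≰m
  ... | yes atp≤m = ⊥-elim (<-irrefl (cong (at i) m≡p) atm<atp)
    where
    p∈interval : Interval i m p
    p∈interval = proj₂ (proj₂ (isolated m Mm)) p dom (<⇒≤ atm<atp , atp≤m)

    m≡p : m ≡ p
    m≡p = ≤-antisym (≤-pred (cut m Mm (s≤s (proj₁ p∈interval)))) (proj₂ p∈interval)

  -- At a cut p + 1 a removed p is the right end of a removed interval [i_p, p].
  count-suc-removed : ∀ {p} → Dom i p → Cut (suc p) → U p → count (suc p) ≡ count (at i p)
  count-suc-removed {p} dom cut (m , Mm , atm≤p , p≤m) =
    count-const (m≤n⇒m≤1+n (at-≤ i pointer dom))
                (λ k atp≤k k<sp (_ , ¬Uk) → ¬Uk (p , Mp , atp≤k , ≤-pred k<sp))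
    where
    Mp : M p
    Mp = subst M (≤-antisym (≤-pred (cut m Mm (s≤s atm≤p))) p≤m) Mm

  Vj-at⊆Vj-suc : ∀ {p y} → Dom i p → Cut (suc p)
               → V (at j) (count (at i p)) y → V (at j) (count (suc p)) y
  Vj-at⊆Vj-suc {p} {y} dom cut v with em {U p}
  ... | yes Up = subst (λ r → V (at j) r y) (sym (count-suc-removed dom cut Up)) v
  ... | no ¬Up = subst (λ r → V (at j) r y) (sym (count-suc-yes (dom , ¬Up)))
                   (there (count p) y (subst (λ r → V (at j) r y) (sym (at-j-count (dom , ¬Up))) v))

  count-preserves-V : ∀ {q x} → (∀ k → k < q → Dom i k) → Cut q
                    → V (at i) q x → ¬ U x → V (at j) (count q) (count x)
  count-preserves-V dom cut (here p) ¬Up =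
    subst (λ r → V (at j) r (count p)) (sym (count-suc-yes (dom p ≤-refl , ¬Up))) (here (count p))
  count-preserves-V {x = x} dom cut (there p .x v) ¬Ux =
    Vj-at⊆Vj-suc domp cut
      (count-preserves-V (λ k k<atp → dom k (<-≤-trans k<atp (m≤n⇒m≤1+n (at-≤ i pointer domp))))
                         (Cut-at domp cut) v ¬Ux)
    where
    domp : Dom i p
    domp = dom p ≤-refl

  module _ (dom₀ : Dom j 0) where

    enum-kept : ∀ n → Dom j n → Kept (enum n)
    enum-kept n dom = proj₁ (enum-spec (∈rankLen⇒IsRank n dom))

    count-enum : ∀ n → Dom j n → count (enum n) ≡ n
    count-enum n dom = proj₂ (enum-spec (∈rankLen⇒IsRank n dom))

    enum-suc-positive : ∀ n → Dom j (suc n) → 0 < enum (suc n)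
    enum-suc-positive n dom = ≤-<-trans z≤n (enum-< (∈rankLen⇒IsRank (suc n) dom) (s≤s z≤n))

    j-pointer : IsPointer j
    j-pointer = dom₀ , n≤0⇒n≡0 at-j-0≤0 , at-j-<
      where
      at-j-0≤0 : at j 0 ≤ 0
      at-j-0≤0 = subst (at j 0 ≤_) (count-enum 0 dom₀)
                   (count-mono (at-≤ i pointer (proj₁ (enum-kept 0 dom₀))))

      at-j-< : ∀ n → Dom j (suc n) → at j (suc n) < suc n
      at-j-< n dom = subst (at j (suc n) <_) (count-enum (suc n) dom)
                       (count-< (Kept-at kept) (at-< i pointer (proj₁ kept) (enum-suc-positive n dom)))
        where
        kept : Kept (enum (suc n))
        kept = enum-kept (suc n) dom

    j-interaction : IsInteraction j
    j-interaction = j-pointer , at-j∈V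
      where
      at-j∈V : ∀ n → Dom j (suc n) → V (at j) (suc n) (at j (suc n))
      at-j∈V n dom = subst (λ r → V (at j) r (at j (suc n))) (count-enum (suc n) dom)
                       (count-preserves-V
                         (λ k k<q → ∈dom-downward (len i) (proj₁ kept) (<⇒≤ k<q))
                         (Kept⇒Cut kept)
                         (at∈V i interaction (proj₁ kept) (enum-suc-positive n dom))
                         (proj₂ (Kept-at kept)))
        where
        kept : Kept (enum (suc n))
        kept = enum-kept (suc n) dom

    j-minus : IsMinus i U j
    j-minus = j-pointer , enum
            , (λ _ n dom → enum-< (∈rankLen⇒IsRank n dom))
            , enum-kept
            , (λ k dom ¬Uk → count k , count∈rankLen k (dom , ¬Uk) , enum-count (dom , ¬Uk))
            , (λ n dom → sym (enum-count (Kept-at (enum-kept n dom))))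

  Dom-j-0 : ¬ (∀ k → Dom i k → U k) → Dom j 0
  Dom-j-0 ¬allRemoved with em {∃ Kept}
  ... | yes (k , kept) = ∈dom-downward rankLen (count∈rankLen k kept) z≤n
  ... | no noneKept = ⊥-elim (¬allRemoved removed)
    where
    removed : ∀ k → Dom i k → U k
    removed k dom with em {U k}
    ... | yes Uk = Uk
    ... | no ¬Uk = ⊥-elim (noneKept (k , dom , ¬Uk))

mainTheorem12 : ExcludedMiddle Level.zero → (i : Seq) → IsInteraction i
    → (M : ℕ → Set) → (∀ m → M m → Dom i m × Isolated i (Interval i m))
    → Isolated i (UnionOfIntervals i M)
    × ((∀ k → Dom i k → UnionOfIntervals i M k)
    ⊎ ∃[ j ] (IsMinus i (UnionOfIntervals i M) j × IsInteraction j))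
mainTheorem12 em i interaction M isolated = U-isolated , removed-or-minus
  where
  open Removal em i interaction M isolated

  removed-or-minus : (∀ k → Dom i k → U k) ⊎ ∃[ j ] (IsMinus i U j × IsInteraction j)
  removed-or-minus with em {∀ k → Dom i k → U k}
  ... | yes allRemoved = inj₁ allRemoved
  ... | no ¬allRemoved = inj₂ (j , j-minus dom₀ , j-interaction dom₀)
    where
    dom₀ : Dom j 0
    dom₀ = Dom-j-0 ¬allRemoved
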